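{- Let $3 \leq k < t$ be integers. Then \[ r_k(t,t)\leq T_{k-2}\left((1+o(1))\,2t\binom{2(t-k+1)}{t-k+1}\right), \] where the $o(1)$ term tends to $0$ as $t\to\infty$.
   Context: $r_k(t,t)$ is the least $n$ such that every $2$-coloring of the edges of the complete $k$-uniform hypergraph $K_n^{(k)}$ contains a copy of $K_t^{(k)}$ all of whose edges have the same color. The tower function is defined by $T_0(x)=x$ and $T_{i+1}(x)=2^{T_i(x)}$. -}

module Defs where

open import Data.Nat using (ℕ; zero; suc; _+_; _*_; _∸_; _^_; _≤_; _/_)
open import Data.Nat.Combinatorics using (_C_)
open import Data.Bool using (Bool)
open import Data.Fin.Subset using (Subset; _⊆_; ∣_∣)
open import Data.Product using (Σ; _×_)
open import Relation.Binary.PropositionalEquality using (_≡_)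

T : ℕ → ℕ → ℕ
T zero x = x
T (suc i) x = 2 ^ T i x

-- A 2-colouring of the edges of K_n^(k): the vertex set is Fin n and an edge is
-- a subset of size k; a colouring assigns a colour to every subset (only the
-- values on k-subsets matter).
Colouring : ℕ → Set
Colouring n = Subset n → Bool

HasMonoClique : (k t n : ℕ) → Colouring n → Set
HasMonoClique k t n c =
  Σ (Subset n) λ S → ∣ S ∣ ≡ t × Σ Bool λ b →
    ((e : Subset n) → e ⊆ S → ∣ e ∣ ≡ k → c e ≡ b)

Arrows : (k t n : ℕ) → Set
Arrows k t n = (c : Colouring n) → HasMonoClique k t n c

IsRamseyNumber : (k t r : ℕ) → Set
IsRamseyNumber k t r = Arrows k t r × ((n : ℕ) → Arrows k t n → r ≤ n)

baseQuantity : (k t : ℕ) → ℕ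
baseQuantity k t = 2 * t * ((2 * (t + 1 ∸ k)) C (t + 1 ∸ k))

boosted : ℕ → ℕ → ℕ
boosted m N = N + N / suc m

-- Triples: insert the vertices one by one into an Erdős–Szekeres search tree, sending x to the
-- right of u when χ {u, x, w} holds for a later vertex w.  Passing at each step to the most
-- frequent position among the remaining vertices (the Erdős–Rado argument) makes every position
-- independent of w, and the Erdős–Szekeres argument then yields a monotone chain of length t − 1,
-- which together with the last vertex is monochromatic.  There are fewer than 2^(2s+1) positions
-- and the tree needs (2s choose s) vertices, s = t − 2, whence r₃(t,t) ≤ 2^(2t (2s choose s)).
-- Quadruples: the same one level up, with a tree branching by Erdős–Szekeres positions computed
-- from 4-sets, and the triple argument run along one branch.  For k ≥ 5 the Erdős–Rado
-- stepping-up lemma adds one level to the tower while t grows by one, which the tower absorbs.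
-- The bound so obtained needs no factor 1 + o(1) and holds for every t > k, so t₀ = 0.

module Submission where

open import Defs
open import Data.Bool using (Bool; true; false)
import Data.Bool.Properties as Bool
open import Data.Empty using (⊥-elim)
open import Data.Fin using (Fin; zero; suc)
open import Data.Fin.Subset using (Subset; ⁅_⁆; _∪_; ∣_∣)
  renaming (_∈_ to _∈ₛ_; _∉_ to _∉ₛ_; _⊆_ to _⊆ₛ_; ⊥ to ∅)
open import Data.Fin.Subset.Properties
  using (_∈?_; _⊆?_; anySubset?; ∉⊥; ∣⊥∣≡0; x∈⁅x⁆; x∈⁅y⁆⇒x≡y; x∈p∪q⁻; x∈p∪q⁺; ∪-identityˡ)
  renaming (⊆-antisym to ⊆ₛ-antisym)
open import Data.List
  using (List; []; _∷_; _++_; [_]; map; length; filter; reverse; _ʳ++_; cartesianProductWith; allFin)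
open import Data.List.Membership.Propositional using (_∈_)
open import Data.List.Membership.Propositional.Properties
  using (∈-++⁺ˡ; ∈-++⁺ʳ; ∈-map⁺; ∈-cartesianProductWith⁺; ∈-filter⁺; ∈-filter⁻)
open import Data.List.Properties
  using ( length-++; length-map; length-reverse; length-tabulate; ++-assoc; ≡-dec; ∷-injective; ∷ʳ-injectiveˡ
        ; reverse-map; reverse-involutive)
open import Data.List.Relation.Binary.Sublist.Propositional
  using (_⊆_; []; _∷_; _∷ʳ_; ⊆-refl; ⊆-trans; minimum; to∈; from∈)
open import Data.List.Relation.Binary.Sublist.Propositional.Properties
  using (All-resp-⊆; Any-resp-⊆; ++⁺; ++⁺ˡ; ++⁺ʳ; filter-⊆)
open import Data.List.Relation.Unary.All as All using (All; []; _∷_)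
open import Data.List.Relation.Unary.All.Properties using (all-filter)
open import Data.List.Relation.Unary.AllPairs using ([]; _∷_)
open import Data.List.Relation.Unary.Any using (here; there)
open import Data.List.Relation.Unary.Unique.Propositional using (Unique)
open import Data.List.Relation.Unary.Unique.Propositional.Properties using (allFin⁺)
open import Data.Maybe using (Maybe; just; nothing)
open import Data.Nat using (ℕ; zero; suc; _+_; _*_; _∸_; _^_; _≤_; _<_; z≤n; s≤s; s≤s⁻¹; _<?_; _≟_)
open import Data.Nat.Combinatorics using (_C_; nCk+nC[k+1]≡[n+1]C[k+1]; nCn≡1)
open import Data.Nat.ListAction using (sum)
open import Data.Nat.Properties
open import Data.Nat.Tactic.RingSolver using (solve-∀)
open import Data.Product using (Σ; _×_; _,_; proj₁; proj₂; ∃; ∃-syntax)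
open import Data.Sum using (_⊎_; inj₁; inj₂)
open import Data.Unit using (⊤; tt)
open import Data.Vec using (Vec; []; _∷_; here; there)
open import Function using (_∘_)
open import Relation.Binary.Definitions using (DecidableEquality)
open import Relation.Binary.PropositionalEquality
  using (_≡_; _≢_; refl; sym; trans; cong; cong₂; subst; subst₂; module ≡-Reasoning)
open import Relation.Nullary using (¬_; ¬?; Dec; yes; no)
open import Relation.Nullary.Decidable using (map′; _×-dec_; _⊎-dec_; _→-dec_; decidable-stable)

module _ {A : Set} where

  Precedes : List A → A → A → Set
  Precedes P x z = x ∷ z ∷ [] ⊆ P

  ¬Precedes-[_] : ∀ x {u v} → ¬ Precedes [ x ] u v
  ¬Precedes-[ x ] (_ ∷ʳ ())
  ¬Precedes-[ x ] (_ ∷ ())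

  Precedes-last : ∀ {x y} xs → x ∈ xs → Precedes (xs ++ [ y ]) x y
  Precedes-last (_ ∷ xs) (here refl) = refl ∷ ++⁺ˡ xs (from∈ (here refl))
  Precedes-last (x ∷ xs) (there x∈xs) = x ∷ʳ Precedes-last xs x∈xs

  length-∷ʳ : ∀ (xs : List A) {y} → length (xs ++ [ y ]) ≡ suc (length xs)
  length-∷ʳ xs = trans (length-++ xs) (+-comm (length xs) 1)

  ⊆-∷ʳ-view : ∀ {e M : List A} {y} → e ⊆ M ++ [ y ] →
              (∃[ e′ ] e ≡ e′ ++ [ y ] × e′ ⊆ M) ⊎ e ⊆ M
  ⊆-∷ʳ-view {M = []} (_ ∷ʳ []) = inj₂ []
  ⊆-∷ʳ-view {M = []} (refl ∷ []) = inj₁ ([] , refl , [])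
  ⊆-∷ʳ-view {M = m ∷ M} (.m ∷ʳ τ) with ⊆-∷ʳ-view τ
  ... | inj₁ (e′ , eq , σ) = inj₁ (e′ , eq , m ∷ʳ σ)
  ... | inj₂ σ = inj₂ (m ∷ʳ σ)
  ⊆-∷ʳ-view {M = m ∷ M} (refl ∷ τ) with ⊆-∷ʳ-view τ
  ... | inj₁ (e′ , refl , σ) = inj₁ (m ∷ e′ , refl , refl ∷ σ)
  ... | inj₂ σ = inj₂ (refl ∷ σ)

  ∷ʳ-⊆-∷ʳ⁻ : ∀ {xs ys : List A} {w y} → xs ++ [ w ] ⊆ ys ++ [ y ] → xs ⊆ ys
  ∷ʳ-⊆-∷ʳ⁻ {xs} {w = w} τ with ⊆-∷ʳ-view τ
  ... | inj₁ (e′ , eq , σ) rewrite ∷ʳ-injectiveˡ xs e′ eq = σ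
  ... | inj₂ σ = ⊆-trans (++⁺ʳ [ w ] ⊆-refl) σ

  lastTwo : ∀ j (e : List A) → length e ≡ suc (suc j) → ∃[ S ] ∃[ x ] ∃[ v ] e ≡ S ++ x ∷ v ∷ [] × length S ≡ j
  lastTwo zero (x ∷ v ∷ []) refl = [] , x , v , refl , refl
  lastTwo (suc j) (a ∷ e) len with S , x , v , refl , lenS ← lastTwo j e (suc-injective len) =
    a ∷ S , x , v , refl , cong suc lenS

  decompose : ∀ {L : Set} S {x R} (Q : List (A × L)) → S ++ x ∷ R ⊆ map proj₁ Q →
              ∃[ Q₁ ] ∃[ ℓ ] ∃[ Q₂ ] Q ≡ Q₁ ++ (x , ℓ) ∷ Q₂ × S ⊆ map proj₁ Q₁ × R ⊆ map proj₁ Q₂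
  decompose [] ((q , ℓ) ∷ Q) (refl ∷ R⊆) = [] , ℓ , Q , refl , [] , R⊆
  decompose [] ((q , ℓ) ∷ Q) (_ ∷ʳ τ) with Q₁ , ℓ′ , Q₂ , refl , S⊆ , R⊆ ← decompose [] Q τ =
    (q , ℓ) ∷ Q₁ , ℓ′ , Q₂ , refl , q ∷ʳ S⊆ , R⊆
  decompose (a ∷ S) ((q , ℓ) ∷ Q) (_ ∷ʳ τ) with Q₁ , ℓ′ , Q₂ , refl , S⊆ , R⊆ ← decompose (a ∷ S) Q τ =
    (q , ℓ) ∷ Q₁ , ℓ′ , Q₂ , refl , q ∷ʳ S⊆ , R⊆
  decompose (a ∷ S) ((q , ℓ) ∷ Q) (refl ∷ τ) with Q₁ , ℓ′ , Q₂ , refl , S⊆ , R⊆ ← decompose S Q τ =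
    (q , ℓ) ∷ Q₁ , ℓ′ , Q₂ , refl , refl ∷ S⊆ , R⊆

  ⊆-unique : ∀ {xs ys : List A} → xs ⊆ ys → Unique ys → Unique xs
  ⊆-unique [] _ = []
  ⊆-unique (_ ∷ʳ τ) (_ ∷ u) = ⊆-unique τ u
  ⊆-unique (refl ∷ τ) (x∉ ∷ u) = All-resp-⊆ τ x∉ ∷ ⊆-unique τ u

  Precedes⇒∈-suffix : ∀ pre {x z R} → Unique (pre ++ x ∷ R) → Precedes (pre ++ x ∷ R) x z → z ∈ R
  Precedes⇒∈-suffix [] (x∉R ∷ _) (_ ∷ʳ τ) = ⊥-elim (All.lookup x∉R (to∈ τ) refl)
  Precedes⇒∈-suffix [] _ (refl ∷ τ) = to∈ τ
  Precedes⇒∈-suffix (_ ∷ pre) (_ ∷ u) (_ ∷ʳ τ) = Precedes⇒∈-suffix pre u τ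
  Precedes⇒∈-suffix (_ ∷ pre) (p∉ ∷ _) (refl ∷ τ) =
    ⊥-elim (All.lookup p∉ (∈-++⁺ʳ pre (here refl)) refl)

map-≡-pointwise : ∀ {A B : Set} {f g : A → B} xs → map f xs ≡ map g xs → ∀ {z} → z ∈ xs → f z ≡ g z
map-≡-pointwise (x ∷ xs) eq (here refl) = proj₁ (∷-injective eq)
map-≡-pointwise (x ∷ xs) eq (there z∈xs) = map-≡-pointwise xs (proj₂ (∷-injective eq)) z∈xs

-- Pigeonhole

m+n<o+p⇒m<o⊎n<p : ∀ {m n o p} → m + n < o + p → m < o ⊎ n < p
m+n<o+p⇒m<o⊎n<p {m} {n} {o} {p} h with m <? o | n <? p
... | yes m<o | _ = inj₁ m<o
... | no _ | yes n<p = inj₂ n<p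
... | no m≮o | no n≮p = ⊥-elim (<⇒≱ h (+-mono-≤ (≮⇒≥ m≮o) (≮⇒≥ n≮p)))

pigeonhole : ∀ {L : Set} (f : L → ℕ) (Ls : List L) {m} →
             m * length Ls < sum (map f Ls) → ∃[ ℓ ] ℓ ∈ Ls × m < f ℓ
pigeonhole f [] {m} h = ⊥-elim (n≮0 (subst (_< 0) (*-zeroʳ m) h))
pigeonhole f (ℓ ∷ Ls) {m} h with m+n<o+p⇒m<o⊎n<p (subst (_< f ℓ + sum (map f Ls)) (*-suc m (length Ls)) h)
... | inj₁ m<fℓ = ℓ , here refl , m<fℓ
... | inj₂ h′ with pigeonhole f Ls h′
...   | ℓ′ , ℓ′∈Ls , m<fℓ′ = ℓ′ , there ℓ′∈Ls , m<fℓ′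

module Classes {X L : Set} (size : L → List X → ℕ)
               (size-mono : ∀ ℓ x xs → size ℓ xs ≤ size ℓ (x ∷ xs)) where

  total : List L → List X → ℕ
  total Ls xs = sum (map (λ ℓ → size ℓ xs) Ls)

  total-mono : ∀ Ls x xs → total Ls xs ≤ total Ls (x ∷ xs)
  total-mono [] x xs = ≤-refl
  total-mono (ℓ ∷ Ls) x xs = +-mono-≤ (size-mono ℓ x xs) (total-mono Ls x xs)

  total-grows : ∀ Ls {ℓ} x xs → ℓ ∈ Ls → size ℓ xs < size ℓ (x ∷ xs) → total Ls xs < total Ls (x ∷ xs)
  total-grows (ℓ ∷ Ls) x xs (here refl) lt = +-mono-<-≤ lt (total-mono Ls x xs)
  total-grows (ℓ′ ∷ Ls) x xs (there ℓ∈Ls) lt = +-mono-≤-< (size-mono ℓ′ x xs) (total-grows Ls x xs ℓ∈Ls lt)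

  Counted : List L → X → Set
  Counted Ls x = ∃[ ℓ ] ℓ ∈ Ls × ∀ xs → size ℓ xs < size ℓ (x ∷ xs)

  length≤total : ∀ Ls xs → All (Counted Ls) xs → length xs ≤ total Ls xs
  length≤total Ls [] [] = z≤n
  length≤total Ls (x ∷ xs) ((ℓ , ℓ∈Ls , grows) ∷ counted) =
    ≤-trans (s≤s (length≤total Ls xs counted)) (total-grows Ls x xs ℓ∈Ls (grows xs))

  largeClass : ∀ Ls xs {m} → All (Counted Ls) xs → m * length Ls < length xs →
               ∃[ ℓ ] ℓ ∈ Ls × m < size ℓ xs
  largeClass Ls xs counted h = pigeonhole (λ ℓ → size ℓ xs) Ls (<-≤-trans h (length≤total Ls xs counted))

module FilterClasses {X L : Set} (_≟_ : DecidableEquality L) (f : X → L) where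

  class : L → List X → List X
  class ℓ = filter (λ x → f x ≟ ℓ)

  class-mono : ∀ ℓ x xs → length (class ℓ xs) ≤ length (class ℓ (x ∷ xs))
  class-mono ℓ x xs with f x ≟ ℓ
  ... | yes _ = n≤1+n _
  ... | no _ = ≤-refl

  class-own : ∀ x xs → length (class (f x) xs) < length (class (f x) (x ∷ xs))
  class-own x xs with f x ≟ f x
  ... | yes _ = ≤-refl
  ... | no f≢f = ⊥-elim (f≢f refl)

  open Classes (λ ℓ xs → length (class ℓ xs)) class-mono

  largeFilterClass : ∀ Ls xs {m} → (∀ x → f x ∈ Ls) → m * length Ls < length xs →
                     ∃[ ℓ ] ℓ ∈ Ls × m < length (class ℓ xs)
  largeFilterClass Ls xs f∈Ls = largeClass Ls xs (All.tabulate (λ {x} _ → f x , f∈Ls x , class-own x))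

-- Erdős–Rado end-homogeneous sequences

treeSize : ℕ → ℕ → ℕ
treeSize M zero = 0
treeSize M (suc n) = suc (M * treeSize M n)

treeSize<^ : ∀ {M} n → 2 ≤ M → treeSize M n < M ^ n
treeSize<^ zero _ = s≤s z≤n
treeSize<^ {M} (suc n) 2≤M = begin-strict
  suc (M * treeSize M n)   <⟨ +-monoˡ-≤ (M * treeSize M n) 2≤M ⟩
  M + M * treeSize M n     ≡⟨ *-suc M (treeSize M n) ⟨
  M * suc (treeSize M n)   ≤⟨ *-monoʳ-≤ M (treeSize<^ n 2≤M) ⟩
  M * M ^ n                ∎
  where open ≤-Reasoning

treeSize-monoˡ : ∀ {M M′} n → M ≤ M′ → treeSize M n ≤ treeSize M′ n
treeSize-monoˡ zero _ = z≤n
treeSize-monoˡ (suc n) M≤M′ = s≤s (*-mono-≤ M≤M′ (treeSize-monoˡ n M≤M′))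

treeSize<suc^ : ∀ {M} n → 1 ≤ M → treeSize M n < suc M ^ n
treeSize<suc^ n 1≤M = ≤-<-trans (treeSize-monoˡ n (n≤1+n _)) (treeSize<^ n (s≤s 1≤M))

-- A label f H x τ may depend on a later vertex τ; in a settled run it is the same for all
-- admissible futures τ of x, and there is one.
Settled : {V L Tok : Set} (Future : V → Tok → Set) (f : List (V × L) → V → Tok → L) →
          List (V × L) → List (V × L) → Set
Settled Future f H [] = ⊤
Settled Future f H ((x , ℓ) ∷ Q) =
  (∀ τ → Future x τ → f H x τ ≡ ℓ) × ∃ (Future x) × Settled Future f ((x , ℓ) ∷ H) Q

module EndHomogeneous {V L : Set} (_≟_ : DecidableEquality L)
         (label : List (V × L) → V → V → L) (Ls : List L) (depth : ℕ)
         (label∈Ls : ∀ H x w → length H < depth → label H x w ∈ Ls) where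

  open FilterClasses using (class; largeFilterClass)

  EndHomogeneous : List (V × L) → List (V × L) → V → Set
  EndHomogeneous H [] y = ⊤
  EndHomogeneous H ((x , ℓ) ∷ Q) y =
    All (λ z → label H x z ≡ ℓ) (map proj₁ Q ++ [ y ]) × EndHomogeneous ((x , ℓ) ∷ H) Q y

  endHomogeneous : ∀ n H (A : List V) → length H + n ≡ depth → treeSize (length Ls) n < length A →
                   ∃[ Q ] ∃[ y ] length Q ≡ n × map proj₁ Q ++ [ y ] ⊆ A × EndHomogeneous H Q y
  endHomogeneous zero H (y ∷ A) _ _ = [] , y , refl , refl ∷ minimum A , tt
  endHomogeneous (suc n) H (v ∷ A) H+n≡depth h =
    extend (largeFilterClass _≟_ (label H v) Ls A (λ z → label∈Ls H v z H<depth) many)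
    where
    H<depth : length H < depth
    H<depth = subst (length H <_) H+n≡depth (m<m+n (length H) (s≤s z≤n))
    many : treeSize (length Ls) n * length Ls < length A
    many = subst (_< length A) (*-comm (length Ls) _) (s≤s⁻¹ h)
    extend : (∃[ ℓ ] ℓ ∈ Ls × treeSize (length Ls) n < length (class _≟_ (label H v) ℓ A)) →
             ∃[ Q ] ∃[ y ] length Q ≡ suc n × map proj₁ Q ++ [ y ] ⊆ v ∷ A × EndHomogeneous H Q y
    extend (ℓ , _ , large)
      with Q , y , refl , τ , hom ← endHomogeneous n ((v , ℓ) ∷ H) (class _≟_ (label H v) ℓ A)
                                                    (trans (sym (+-suc (length H) n)) H+n≡depth) large
      = (v , ℓ) ∷ Q , y , refl , refl ∷ ⊆-trans τ (filter-⊆ (λ z → label H v z ≟ ℓ) A) ,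
        All-resp-⊆ τ (all-filter (λ z → label H v z ≟ ℓ) A) , hom

  endHomogeneous-at : ∀ H Q₁ {x ℓ Q₂ y} → EndHomogeneous H (Q₁ ++ (x , ℓ) ∷ Q₂) y →
                      All (λ z → label (Q₁ ʳ++ H) x z ≡ ℓ) (map proj₁ Q₂ ++ [ y ])
  endHomogeneous-at H [] (hom , _) = hom
  endHomogeneous-at H (q ∷ Q₁) (_ , homs) = endHomogeneous-at (q ∷ H) Q₁ homs

  endHomogeneous⇒settled : ∀ P pre H Q {y} → P ≡ pre ++ map proj₁ Q ++ [ y ] → Unique P →
                           EndHomogeneous H Q y → Settled (Precedes P) label H Q
  endHomogeneous⇒settled P pre H [] _ _ _ = tt
  endHomogeneous⇒settled P pre H ((x , ℓ) ∷ Q) {y} refl unique (hom , homs) =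
    (λ z x≺z → All.lookup hom (Precedes⇒∈-suffix pre unique x≺z)) ,
    (y , ++⁺ˡ pre (Precedes-last (x ∷ map proj₁ Q) (here refl))) ,
    endHomogeneous⇒settled P (pre ++ [ x ]) ((x , ℓ) ∷ H) Q (sym (++-assoc pre [ x ] _)) unique homs

-- A search tree is stored as the list of its vertices with their addresses, latest first;
-- the root has the empty address.

module Addressed {V L : Set} (_≟_ : DecidableEquality L) where

  root : List (V × List L) → Maybe V
  root [] = nothing
  root ((x , []) ∷ H) = just x
  root ((_ , _ ∷ _) ∷ H) = root H

  subtree : L → List (V × List L) → List (V × List L)
  subtree ℓ [] = []
  subtree ℓ ((x , []) ∷ H) = subtree ℓ H
  subtree ℓ ((x , ℓ′ ∷ α) ∷ H) with ℓ′ ≟ ℓ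
  ... | yes _ = (x , α) ∷ subtree ℓ H
  ... | no _ = subtree ℓ H

  subtree-accept : ∀ ℓ x α H → subtree ℓ ((x , ℓ ∷ α) ∷ H) ≡ (x , α) ∷ subtree ℓ H
  subtree-accept ℓ x α H with ℓ ≟ ℓ
  ... | yes _ = refl
  ... | no ℓ≢ℓ = ⊥-elim (ℓ≢ℓ refl)

  subtree-mono : ∀ ℓ e H → length (subtree ℓ H) ≤ length (subtree ℓ (e ∷ H))
  subtree-mono ℓ (x , []) H = ≤-refl
  subtree-mono ℓ (x , ℓ′ ∷ α) H with ℓ′ ≟ ℓ
  ... | yes _ = n≤1+n _
  ... | no _ = ≤-refl

  subtree-⊆ : ∀ ℓ H → map proj₁ (subtree ℓ H) ⊆ map proj₁ H
  subtree-⊆ ℓ [] = []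
  subtree-⊆ ℓ ((x , []) ∷ H) = x ∷ʳ subtree-⊆ ℓ H
  subtree-⊆ ℓ ((x , ℓ′ ∷ α) ∷ H) with ℓ′ ≟ ℓ
  ... | yes _ = refl ∷ subtree-⊆ ℓ H
  ... | no _ = x ∷ʳ subtree-⊆ ℓ H

  NonRoot : List (V × List L) → Set
  NonRoot = All (λ e → proj₂ e ≢ [])

  root-last : ∀ H p → NonRoot H → root (H ++ [ (p , []) ]) ≡ just p
  root-last [] p _ = refl
  root-last ((x , []) ∷ H) p ([]≢[] ∷ _) = ⊥-elim ([]≢[] refl)
  root-last ((x , _ ∷ _) ∷ H) p (_ ∷ nonRoot) = root-last H p nonRoot

  subtree-last : ∀ ℓ H p → subtree ℓ (H ++ [ (p , []) ]) ≡ subtree ℓ H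
  subtree-last ℓ [] p = refl
  subtree-last ℓ ((x , []) ∷ H) p = subtree-last ℓ H p
  subtree-last ℓ ((x , ℓ′ ∷ α) ∷ H) p with ℓ′ ≟ ℓ
  ... | yes _ = cong ((x , α) ∷_) (subtree-last ℓ H p)
  ... | no _ = subtree-last ℓ H p

  open Classes (λ ℓ H → length (subtree ℓ H)) subtree-mono public

  module Split {Tok : Set} (Future : V → Tok → Set) (address : List (V × List L) → V → Tok → List L)
               (p : V) (edge : V → Tok → L) (Ls : List L) (edge∈Ls : ∀ x τ → edge x τ ∈ Ls)
               (child : L → List (V × List L) → V → Tok → List L)
               (address-root : ∀ H x τ → root H ≡ just p →
                               address H x τ ≡ edge x τ ∷ child (edge x τ) (subtree (edge x τ) H) x τ)
               where

    Splitting : List (V × List L) → List (V × List L) → Set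
    Splitting hist Q =
      (∀ ℓ → Settled Future (child ℓ) (subtree ℓ hist) (subtree ℓ Q) ×
             All (λ x → ∀ τ → Future x τ → edge x τ ≡ ℓ) (map proj₁ (subtree ℓ Q))) ×
      All (Counted Ls) Q

    split : ∀ hist Q → NonRoot hist → Settled Future address (hist ++ [ (p , []) ]) Q → Splitting hist Q
    split hist [] _ _ = (λ ℓ → tt , []) , []
    split hist ((x , α) ∷ Q) nonRoot (agrees , (τ₀ , future₀) , settled) = splitAt α agrees settled
      where
      H : List (V × List L)
      H = hist ++ [ (p , []) ]
      unfold : ∀ τ → address H x τ ≡ edge x τ ∷ child (edge x τ) (subtree (edge x τ) hist) x τ
      unfold τ = trans (address-root H x τ (root-last hist p nonRoot))
                       (cong (λ H′ → edge x τ ∷ child (edge x τ) H′ x τ) (subtree-last (edge x τ) hist p))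
      splitAt : ∀ α → (∀ τ → Future x τ → address H x τ ≡ α) →
                Settled Future address ((x , α) ∷ H) Q → Splitting hist ((x , α) ∷ Q)
      splitAt [] agrees′ _ with () ← trans (sym (unfold τ₀)) (agrees′ τ₀ future₀)
      splitAt (ℓ′ ∷ α′) agrees′ settled′ = parts , counted ∷ proj₂ IH
        where
        edge≡ : ∀ τ → Future x τ → edge x τ ≡ ℓ′
        edge≡ τ fut = proj₁ (∷-injective (trans (sym (unfold τ)) (agrees′ τ fut)))
        child≡ : ∀ τ → Future x τ → child ℓ′ (subtree ℓ′ hist) x τ ≡ α′
        child≡ τ fut = subst (λ ℓ → child ℓ (subtree ℓ hist) x τ ≡ α′) (edge≡ τ fut)
                             (proj₂ (∷-injective (trans (sym (unfold τ)) (agrees′ τ fut))))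
        IH : Splitting ((x , ℓ′ ∷ α′) ∷ hist) Q
        IH = split ((x , ℓ′ ∷ α′) ∷ hist) Q ((λ ()) ∷ nonRoot) settled′
        counted : Counted Ls (x , ℓ′ ∷ α′)
        counted = ℓ′ , subst (_∈ Ls) (edge≡ τ₀ future₀) (edge∈Ls x τ₀) ,
                  λ H′ → ≤-reflexive (sym (cong length (subtree-accept ℓ′ x α′ H′)))
        parts : ∀ ℓ → Settled Future (child ℓ) (subtree ℓ hist) (subtree ℓ ((x , ℓ′ ∷ α′) ∷ Q)) ×
                      All (λ x → ∀ τ → Future x τ → edge x τ ≡ ℓ) (map proj₁ (subtree ℓ ((x , ℓ′ ∷ α′) ∷ Q)))
        parts ℓ with ℓ′ ≟ ℓ | proj₁ IH ℓ
        ... | yes refl | settledℓ , edgesℓ = (child≡ , (τ₀ , future₀) , settledℓ) , edge≡ ∷ edgesℓ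
        ... | no _ | settledℓ , edgesℓ = settledℓ , edgesℓ

-- Erdős–Szekeres search trees

bits : List Bool
bits = true ∷ false ∷ []

bit∈bits : ∀ c → c ∈ bits
bit∈bits true = here refl
bit∈bits false = there (here refl)

All∈bits : ∀ (σ : List Bool) → All (_∈ bits) σ
All∈bits σ = All.tabulate (λ {c} _ → bit∈bits c)

erdősSzekeres : ℕ → ℕ → ℕ
erdősSzekeres zero b = 0
erdősSzekeres (suc a) zero = 0
erdősSzekeres (suc a) (suc b) = suc (erdősSzekeres a (suc b) + erdősSzekeres (suc a) b)

-- A vertex x is inserted below u to the right (true) or left (false) according to bit u x τ;
-- a right step uses up one of a, a left step one of b.
module SearchTree {V Tok : Set} (bit : V → V → Tok → Bool) where

  open Addressed {V} Bool._≟_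

  position : ℕ → ℕ → List (V × List Bool) → V → Tok → List Bool
  child : ℕ → ℕ → Bool → List (V × List Bool) → V → Tok → List Bool

  position zero b H x τ = []
  position (suc a) zero H x τ = []
  position (suc a) (suc b) H x τ with root H
  ... | nothing = []
  ... | just u = bit u x τ ∷ child a b (bit u x τ) (subtree (bit u x τ) H) x τ

  child a b true = position a (suc b)
  child a b false = position (suc a) b

  position-root : ∀ a b p H x τ → root H ≡ just p →
                  position (suc a) (suc b) H x τ ≡ bit p x τ ∷ child a b (bit p x τ) (subtree (bit p x τ) H) x τ
  position-root a b p H x τ root≡p with root H
  position-root a b p H x τ refl | just .p = refl

  length-position : ∀ a b H x τ → length (position a b H x τ) ≤ a + b
  length-position zero b H x τ = z≤n
  length-position (suc a) zero H x τ = z≤n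
  length-position (suc a) (suc b) H x τ with root H
  ... | nothing = z≤n
  ... | just u with bit u x τ
  ...   | true = s≤s (length-position a (suc b) _ x τ)
  ...   | false = s≤s (≤-trans (length-position (suc a) b _ x τ) (≤-reflexive (sym (+-suc a b))))

  length≤subtrees : ∀ Q → All (Counted bits) Q → length Q ≤ length (subtree true Q) + length (subtree false Q)
  length≤subtrees Q counted =
    subst (length Q ≤_) (cong (length (subtree true Q) +_) (+-identityʳ _)) (length≤total bits Q counted)

  module _ (Future : V → Tok → Set) where

    Monotone : Bool → List V → Set
    Monotone c K = ∀ u v τ → Precedes K u v → Future v τ → bit u v τ ≡ c

    MonotoneChain : ℕ → ℕ → List V → Set
    MonotoneChain a b A =
      ∃[ K ] K ⊆ A × (length K ≡ suc a × Monotone true K ⊎ length K ≡ suc b × Monotone false K)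

    Edges : Bool → V → List V → Set
    Edges c p = All (λ v → ∀ τ → Future v τ → bit p v τ ≡ c)

    monotone-[_] : ∀ x {c} → Monotone c [ x ]
    monotone-[ x ] u v τ u≺v = ⊥-elim (¬Precedes-[ x ] u≺v)

    monotone-∷ : ∀ {c p K} → Edges c p K → Monotone c K → Monotone c (p ∷ K)
    monotone-∷ edges mono u v τ (_ ∷ʳ u≺v) = mono u v τ u≺v
    monotone-∷ edges mono _ v τ (refl ∷ v∈K) = All.lookup edges (to∈ v∈K) τ

    module Below (a b : ℕ) (p : V) =
      Split Future (position (suc a) (suc b)) p (bit p) bits (λ x τ → bit∈bits (bit p x τ))
            (child a b) (position-root a b p)

    rightStep : ∀ {a b p Q} → Edges true p (map proj₁ (subtree true Q)) →
                MonotoneChain a (suc b) (map proj₁ (subtree true Q)) →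
                MonotoneChain (suc a) (suc b) (p ∷ map proj₁ Q)
    rightStep {Q = Q} edges (K , K⊆ , inj₁ (len , mono)) =
      _ ∷ K , refl ∷ ⊆-trans K⊆ (subtree-⊆ true Q) , inj₁ (cong suc len , monotone-∷ (All-resp-⊆ K⊆ edges) mono)
    rightStep {Q = Q} edges (K , K⊆ , inj₂ chain) = K , _ ∷ʳ ⊆-trans K⊆ (subtree-⊆ true Q) , inj₂ chain

    leftStep : ∀ {a b p Q} → Edges false p (map proj₁ (subtree false Q)) →
               MonotoneChain (suc a) b (map proj₁ (subtree false Q)) →
               MonotoneChain (suc a) (suc b) (p ∷ map proj₁ Q)
    leftStep {Q = Q} edges (K , K⊆ , inj₁ chain) = K , _ ∷ʳ ⊆-trans K⊆ (subtree-⊆ false Q) , inj₁ chain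
    leftStep {Q = Q} edges (K , K⊆ , inj₂ (len , mono)) =
      _ ∷ K , refl ∷ ⊆-trans K⊆ (subtree-⊆ false Q) , inj₂ (cong suc len , monotone-∷ (All-resp-⊆ K⊆ edges) mono)

    monotoneChain : ∀ a b Q → Settled Future (position a b) [] Q → erdősSzekeres a b < length Q →
                    MonotoneChain a b (map proj₁ Q)
    monotoneChain zero b ((x , _) ∷ Q) _ _ = [ x ] , refl ∷ minimum _ , inj₁ (refl , monotone-[ x ])
    monotoneChain (suc a) zero ((x , _) ∷ Q) _ _ = [ x ] , refl ∷ minimum _ , inj₂ (refl , monotone-[ x ])
    monotoneChain (suc a) (suc b) ((p , α) ∷ Q) (agrees , (τ₀ , future₀) , settled) h
      with refl ← agrees τ₀ future₀
      with parts , counted ← Below.split a b p [] Q [] settled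
      with m+n<o+p⇒m<o⊎n<p (<-≤-trans (s≤s⁻¹ h) (length≤subtrees Q counted))
    ... | inj₁ right = rightStep (proj₂ (parts true)) (monotoneChain a (suc b) _ (proj₁ (parts true)) right)
    ... | inj₂ left = leftStep (proj₂ (parts false)) (monotoneChain (suc a) b _ (proj₁ (parts false)) left)

    diagonalMonotoneChain : ∀ s Q → Settled Future (position s s) [] Q → erdősSzekeres s s < length Q →
                     ∃[ K ] K ⊆ map proj₁ Q × length K ≡ suc s × ∃[ c ] Monotone c K
    diagonalMonotoneChain s Q settled h with monotoneChain s s Q settled h
    ... | K , K⊆Q , inj₁ (len , mono) = K , K⊆Q , len , true , mono
    ... | K , K⊆Q , inj₂ (len , mono) = K , K⊆Q , len , false , mono

-- Search trees whose edge labels label Anc u x τ depend on the ancestors Anc of u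

module LabelTree {V Tok L : Set} (_≟_ : DecidableEquality L)
                 (label : List (V × L) → V → V → Tok → L) (Ls : List L)
                 (label∈Ls : ∀ Anc u x τ → label Anc u x τ ∈ Ls) where

  open Addressed {V} _≟_

  address : ℕ → List (V × L) → List (V × List L) → V → Tok → List L
  address zero Anc H x τ = []
  address (suc n) Anc H x τ with root H
  ... | nothing = []
  ... | just u = label Anc u x τ ∷ address n ((u , label Anc u x τ) ∷ Anc) (subtree (label Anc u x τ) H) x τ

  address-root : ∀ n Anc p H x τ → root H ≡ just p →
                 address (suc n) Anc H x τ ≡
                 label Anc p x τ ∷ address n ((p , label Anc p x τ) ∷ Anc) (subtree (label Anc p x τ) H) x τ
  address-root n Anc p H x τ root≡p with root H
  address-root n Anc p H x τ refl | just .p = refl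

  length-address : ∀ n Anc H x τ → length (address n Anc H x τ) ≤ n
  length-address zero Anc H x τ = z≤n
  length-address (suc n) Anc H x τ with root H
  ... | nothing = z≤n
  ... | just u = s≤s (length-address n _ _ x τ)

  address⊆Ls : ∀ n Anc H x τ → All (_∈ Ls) (address n Anc H x τ)
  address⊆Ls zero Anc H x τ = []
  address⊆Ls (suc n) Anc H x τ with root H
  ... | nothing = []
  ... | just u = label∈Ls Anc u x τ ∷ address⊆Ls n _ _ x τ

  module _ (Future : V → Tok → Set) where

    Branch : List (V × L) → List (V × L) → V → Set
    Branch Anc [] y = ⊤
    Branch Anc ((q , ℓ) ∷ R) y =
      All (λ v → ∀ τ → Future v τ → label Anc q v τ ≡ ℓ) (map proj₁ R ++ [ y ]) × Branch ((q , ℓ) ∷ Anc) R y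

    module Below (n : ℕ) (Anc : List (V × L)) (p : V) =
      Split Future (address (suc n) Anc) p (label Anc p) Ls (label∈Ls Anc p)
            (λ ℓ → address n ((p , ℓ) ∷ Anc)) (address-root n Anc p)

    branch : ∀ n Anc Q → Settled Future (address n Anc) [] Q → treeSize (length Ls) n < length Q →
             ∃[ R ] ∃[ y ] length R ≡ n × map proj₁ R ++ [ y ] ⊆ map proj₁ Q × Branch Anc R y
    branch zero Anc ((x , _) ∷ Q) _ _ = [] , x , refl , refl ∷ minimum _ , tt
    branch (suc n) Anc ((p , α) ∷ Q) (agrees , (τ₀ , future₀) , settled) h
      with refl ← agrees τ₀ future₀
      with parts , counted ← Below.split n Anc p [] Q [] settled
      with ℓ , _ , large ← largeClass Ls Q counted (subst (_< length Q) (*-comm (length Ls) _) (s≤s⁻¹ h))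
      with R , y , refl , τ , br ← branch n ((p , ℓ) ∷ Anc) (subtree ℓ Q) (proj₁ (parts ℓ)) large
      = (p , ℓ) ∷ R , y , refl , refl ∷ ⊆-trans τ (subtree-⊆ ℓ Q) , All-resp-⊆ τ (proj₂ (parts ℓ)) , br

module _ {A : Set} where

  length-cartesianProductWith : ∀ {B D : Set} (f : A → B → D) xs ys →
                                length (cartesianProductWith f xs ys) ≡ length xs * length ys
  length-cartesianProductWith f [] ys = refl
  length-cartesianProductWith f (x ∷ xs) ys = begin
    length (map (f x) ys ++ cartesianProductWith f xs ys)   ≡⟨ length-++ (map (f x) ys) ⟩
    length (map (f x) ys) + length (cartesianProductWith f xs ys)
      ≡⟨ cong₂ _+_ (length-map (f x) ys) (length-cartesianProductWith f xs ys) ⟩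
    length ys + length xs * length ys   ∎
    where open ≡-Reasoning

  words : ℕ → List A → List (List A)
  words zero E = [ [] ]
  words (suc n) E = [] ∷ cartesianProductWith _∷_ E (words n E)

  length-words : ∀ n E → length (words n E) ≡ treeSize (length E) (suc n)
  length-words zero E = cong suc (sym (*-zeroʳ (length E)))
  length-words (suc n) E =
    cong suc (trans (length-cartesianProductWith _∷_ E (words n E)) (cong (length E *_) (length-words n E)))

  ∈-words : ∀ n E {α} → length α ≤ n → All (_∈ E) α → α ∈ words n E
  ∈-words zero E {[]} _ _ = here refl
  ∈-words (suc n) E {[]} _ _ = here refl
  ∈-words (suc n) E {e ∷ α} (s≤s α≤n) (e∈E ∷ α⊆E) =
    there (∈-cartesianProductWith⁺ _∷_ e∈E (∈-words n E α≤n α⊆E))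

  sublistsOfLength : ℕ → List A → List (List A)
  sublistsOfLength zero xs = [ [] ]
  sublistsOfLength (suc j) [] = []
  sublistsOfLength (suc j) (x ∷ xs) = map (x ∷_) (sublistsOfLength j xs) ++ sublistsOfLength (suc j) xs

  ∈-sublistsOfLength : ∀ j {S xs : List A} → S ⊆ xs → length S ≡ j → S ∈ sublistsOfLength j xs
  ∈-sublistsOfLength zero {[]} _ _ = here refl
  ∈-sublistsOfLength (suc j) (y ∷ʳ S⊆xs) len =
    ∈-++⁺ʳ (map (y ∷_) (sublistsOfLength j _)) (∈-sublistsOfLength (suc j) S⊆xs len)
  ∈-sublistsOfLength (suc j) (refl ∷ S⊆xs) len =
    ∈-++⁺ˡ (∈-map⁺ (_ ∷_) (∈-sublistsOfLength j S⊆xs (suc-injective len)))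

  length-sublistsOfLength : ∀ j (xs : List A) → length (sublistsOfLength j xs) ≤ length xs ^ j
  length-sublistsOfLength zero xs = ≤-refl
  length-sublistsOfLength (suc j) [] = z≤n
  length-sublistsOfLength (suc j) (x ∷ xs) = begin
    length (map (x ∷_) (sublistsOfLength j xs) ++ sublistsOfLength (suc j) xs)
      ≡⟨ trans (length-++ (map (x ∷_) (sublistsOfLength j xs)))
               (cong (_+ length (sublistsOfLength (suc j) xs)) (length-map (x ∷_) (sublistsOfLength j xs))) ⟩
    length (sublistsOfLength j xs) + length (sublistsOfLength (suc j) xs)
      ≤⟨ +-mono-≤ (length-sublistsOfLength j xs) (length-sublistsOfLength (suc j) xs) ⟩
    n ^ j + n * n ^ j
      ≤⟨ +-mono-≤ (^-monoˡ-≤ j (n≤1+n n)) (*-monoʳ-≤ n (^-monoˡ-≤ j (n≤1+n n))) ⟩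
    suc n ^ j + n * suc n ^ j   ∎
    where
    open ≤-Reasoning
    n : ℕ
    n = length xs

-- Colourings of the k-element sublists of a list of distinct vertices

Homogeneous : {V : Set} → ℕ → Bool → (List V → Bool) → List V → Set
Homogeneous k c χ M = ∀ e → e ⊆ M → length e ≡ k → χ e ≡ c

ListArrows : Set → ℕ → ℕ → ℕ → Set
ListArrows V k t N = ∀ (A : List V) → Unique A → N ≤ length A → (χ : List V → Bool) →
                     ∃[ M ] M ⊆ A × length M ≡ t × ∃[ c ] Homogeneous k c χ M

ListArrows-mono : ∀ {V k t N N′} → N ≤ N′ → ListArrows V k t N → ListArrows V k t N′
ListArrows-mono N≤N′ arrows A unique N′≤A = arrows A unique (≤-trans N≤N′ N′≤A)

-- Triples

positionLabels : ℕ → List (List Bool)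
positionLabels s = words (s + s) bits

branchLength : ℕ → ℕ
branchLength s = suc (erdősSzekeres s s)

module Triples {V : Set} (s : ℕ) (χ : List V → Bool) where

  open SearchTree (λ u x z → χ (u ∷ x ∷ z ∷ []))

  label∈Ls : ∀ H x w → length H < branchLength s → position s s H x w ∈ positionLabels s
  label∈Ls H x w _ = ∈-words (s + s) bits (length-position s s H x w) (All∈bits _)

  open EndHomogeneous (≡-dec Bool._≟_) (position s s) (positionLabels s) (branchLength s) label∈Ls

  monotone⇒homogeneous : ∀ {P K y c} → K ++ [ y ] ⊆ P → Monotone (Precedes P) c K → Homogeneous 3 c χ (K ++ [ y ])
  monotone⇒homogeneous M⊆P mono (α ∷ β ∷ γ ∷ []) e⊆M refl =
    mono α β γ (∷ʳ-⊆-∷ʳ⁻ {xs = α ∷ β ∷ []} e⊆M) (⊆-trans (α ∷ʳ ⊆-refl) (⊆-trans e⊆M M⊆P))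

  homogeneousSubset : ∀ A → Unique A → suc (treeSize (length (positionLabels s)) (branchLength s)) ≤ length A →
                      ∃[ M ] M ⊆ A × length M ≡ suc (suc s) × ∃[ c ] Homogeneous 3 c χ M
  homogeneousSubset A unique h
    with Q , y , lenQ , P⊆A , hom ← endHomogeneous (branchLength s) [] A refl h
    with K , K⊆Q , lenK , c , mono ← diagonalMonotoneChain (Precedes (map proj₁ Q ++ [ y ])) s Q
                                       (endHomogeneous⇒settled _ [] [] Q refl (⊆-unique P⊆A unique) hom)
                                       (subst (erdősSzekeres s s <_) (sym lenQ) ≤-refl)
    = K ++ [ y ] , ⊆-trans (++⁺ K⊆Q ⊆-refl) P⊆A , trans (length-∷ʳ K) (cong suc lenK) ,
      c , monotone⇒homogeneous (++⁺ K⊆Q ⊆-refl) mono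

triples : ∀ {V} s → ListArrows V 3 (suc (suc s)) (suc (treeSize (length (positionLabels s)) (branchLength s)))
triples s A unique h χ = Triples.homogeneousSubset s χ A unique h

-- Quadruples

addressLabels : ℕ → List (List (List Bool))
addressLabels s = words (branchLength s) (positionLabels s)

quadrupleDepth : ℕ → ℕ
quadrupleDepth s = suc (treeSize (length (positionLabels s)) (branchLength s))

-- x goes below u along the Erdős–Szekeres position of u among its ancestors, computed from the
-- 4-sets {a, u, x, w}; along a branch these positions are settled, so the branch is an
-- Erdős–Szekeres search tree with futures (x, w).
module Quadruples {V : Set} (s : ℕ) (χ : List V → Bool) where

  private
    module ES = SearchTree {V} {V × V} (λ a u τ → χ (a ∷ u ∷ proj₁ τ ∷ proj₂ τ ∷ []))

  label : List (V × List Bool) → V → V → V → List Bool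
  label Anc u x w = ES.position s s Anc u (x , w)

  label∈Ls : ∀ Anc u x w → label Anc u x w ∈ positionLabels s
  label∈Ls Anc u x w =
    ∈-words (s + s) bits (ES.length-position s s Anc u (x , w)) (All∈bits _)

  open LabelTree (≡-dec Bool._≟_) label (positionLabels s) label∈Ls

  address∈Ls : ∀ H x w → length H < quadrupleDepth s → address (branchLength s) [] H x w ∈ addressLabels s
  address∈Ls H x w _ = ∈-words (branchLength s) (positionLabels s) (length-address (branchLength s) [] H x w)
                                (address⊆Ls (branchLength s) [] H x w)

  open EndHomogeneous (≡-dec (≡-dec Bool._≟_)) (address (branchLength s) []) (addressLabels s) (quadrupleDepth s)
                      address∈Ls

  Future₂ : List V → List V → V → V × V → Set
  Future₂ B P u (x , w) = Precedes B u x × Precedes P x w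

  branch⇒settled : ∀ B P pre Anc R {y yo} → B ≡ pre ++ map proj₁ R ++ [ y ] → Unique B → Precedes P y yo →
                   Branch (Precedes P) Anc R y → Settled (Future₂ B P) (ES.position s s) Anc R
  branch⇒settled B P pre Anc [] _ _ _ _ = tt
  branch⇒settled B P pre Anc ((q , ℓ) ∷ R) {y} {yo} refl unique y≺yo (agrees , br) =
    (λ { (x , w) (q≺x , x≺w) → All.lookup agrees (Precedes⇒∈-suffix pre unique q≺x) w x≺w }) ,
    ((y , yo) , ++⁺ˡ pre (Precedes-last (q ∷ map proj₁ R) (here refl)) , y≺yo) ,
    branch⇒settled B P (pre ++ [ q ]) ((q , ℓ) ∷ Anc) R (sym (++-assoc pre [ q ] _)) unique y≺yo br

  monotone⇒homogeneous : ∀ {B P K y yo c} → K ++ [ y ] ⊆ B → (K ++ [ y ]) ++ [ yo ] ⊆ P →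
                         ES.Monotone (Future₂ B P) c K → Homogeneous 4 c χ ((K ++ [ y ]) ++ [ yo ])
  monotone⇒homogeneous {K = K} {y} K′⊆B M⊆P mono (α ∷ β ∷ γ ∷ δ ∷ []) e⊆M refl =
    mono α β (γ , δ) (∷ʳ-⊆-∷ʳ⁻ {xs = α ∷ β ∷ []} αβγ⊆K′)
         (⊆-trans (α ∷ʳ ⊆-refl) (⊆-trans αβγ⊆K′ K′⊆B) , ⊆-trans (α ∷ʳ β ∷ʳ ⊆-refl) (⊆-trans e⊆M M⊆P))
    where
    αβγ⊆K′ : α ∷ β ∷ γ ∷ [] ⊆ K ++ [ y ]
    αβγ⊆K′ = ∷ʳ-⊆-∷ʳ⁻ {xs = α ∷ β ∷ γ ∷ []} e⊆M

  homogeneousSubset : ∀ A → Unique A → suc (treeSize (length (addressLabels s)) (quadrupleDepth s)) ≤ length A →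
                      ∃[ M ] M ⊆ A × length M ≡ suc (suc (suc s)) × ∃[ c ] Homogeneous 4 c χ M
  homogeneousSubset A unique h
    with Q , yo , lenQ , P⊆A , hom ← endHomogeneous (quadrupleDepth s) [] A refl h
    with R , y , lenR , B⊆Q , br ← branch (Precedes (map proj₁ Q ++ [ yo ])) (branchLength s) [] Q
                                     (endHomogeneous⇒settled _ [] [] Q refl (⊆-unique P⊆A unique) hom)
                                     (subst (treeSize (length (positionLabels s)) (branchLength s) <_) (sym lenQ) ≤-refl)
    with K , K⊆R , lenK , c , mono
           ← ES.diagonalMonotoneChain (Future₂ (map proj₁ R ++ [ y ]) (map proj₁ Q ++ [ yo ])) s R
           (branch⇒settled _ _ [] [] R refl (⊆-unique (⊆-trans B⊆Q (⊆-trans (++⁺ʳ [ yo ] ⊆-refl) P⊆A)) unique)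
                           (Precedes-last (map proj₁ Q) (Any-resp-⊆ B⊆Q (∈-++⁺ʳ (map proj₁ R) (here refl)))) br)
           (subst (erdősSzekeres s s <_) (sym lenR) ≤-refl)
    = (K ++ [ y ]) ++ [ yo ] , ⊆-trans M⊆P P⊆A ,
      trans (length-∷ʳ (K ++ [ y ])) (cong suc (trans (length-∷ʳ K) (cong suc lenK))) ,
      c , monotone⇒homogeneous (++⁺ K⊆R ⊆-refl) M⊆P mono
    where
    M⊆P : (K ++ [ y ]) ++ [ yo ] ⊆ map proj₁ Q ++ [ yo ]
    M⊆P = ++⁺ (⊆-trans (++⁺ K⊆R ⊆-refl) B⊆Q) ⊆-refl

quadruples : ∀ {V} s → ListArrows V 4 (suc (suc (suc s)))
               (suc (treeSize (length (addressLabels s)) (quadrupleDepth s)))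
quadruples s A unique h χ = Quadruples.homogeneousSubset s χ A unique h

-- Stepping up

steppingLabels : ℕ → ℕ → List (List Bool)
steppingLabels j L = words (L ^ j) bits

module SteppingUp {V : Set} (j t L : ℕ) (arrows : ListArrows V (suc j) t L) (χ : List V → Bool) where

  label : List (V × List Bool) → V → V → List Bool
  label H x w = map (λ S → χ (S ++ x ∷ w ∷ [])) (sublistsOfLength j (reverse (map proj₁ H)))

  label∈Ls : ∀ H x w → length H < L → label H x w ∈ steppingLabels j L
  label∈Ls H x w H<L = ∈-words (L ^ j) bits length≤ (All∈bits _)
    where
    open ≤-Reasoning
    earlier : List V
    earlier = reverse (map proj₁ H)
    length≤ : length (label H x w) ≤ L ^ j
    length≤ = begin
      length (label H x w)                  ≡⟨ length-map _ (sublistsOfLength j earlier) ⟩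
      length (sublistsOfLength j earlier)   ≤⟨ length-sublistsOfLength j earlier ⟩
      length earlier ^ j                    ≡⟨ cong (_^ j) (trans (length-reverse (map proj₁ H)) (length-map proj₁ H)) ⟩
      length H ^ j                          ≤⟨ ^-monoˡ-≤ j (<⇒≤ H<L) ⟩
      L ^ j                                 ∎

  open EndHomogeneous (≡-dec Bool._≟_) label (steppingLabels j L) L label∈Ls

  colour-∷ʳ : ∀ (Q₁ : List (V × List Bool)) {x ℓ} {Q₂ : List (V × List Bool)} {y S v} →
              All (λ z → label (reverse Q₁) x z ≡ ℓ) (map proj₁ Q₂ ++ [ y ]) →
              S ⊆ map proj₁ Q₁ → length S ≡ j → v ∈ map proj₁ Q₂ → χ (S ++ x ∷ v ∷ []) ≡ χ (S ++ x ∷ y ∷ [])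
  colour-∷ʳ Q₁ {x} {ℓ} {Q₂} {y} {S} {v} agrees S⊆Q₁ lenS v∈Q₂ =
    map-≡-pointwise {f = λ S′ → χ (S′ ++ x ∷ v ∷ [])} {g = λ S′ → χ (S′ ++ x ∷ y ∷ [])} _
                    (trans (All.lookup agrees (∈-++⁺ˡ v∈Q₂))
                           (sym (All.lookup agrees (∈-++⁺ʳ (map proj₁ Q₂) (here refl)))))
                    (subst (λ xs → S ∈ sublistsOfLength j xs) (sym reverse-reverse)
                           (∈-sublistsOfLength j S⊆Q₁ lenS))
    where
    reverse-reverse : reverse (map proj₁ (reverse Q₁)) ≡ map proj₁ Q₁
    reverse-reverse = trans (cong reverse (reverse-map proj₁ Q₁)) (reverse-involutive (map proj₁ Q₁))

  homogeneous-∷ʳ : ∀ Q {y M c} → EndHomogeneous [] Q y → M ⊆ map proj₁ Q →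
                   Homogeneous (suc j) c (λ e → χ (e ++ [ y ])) M → Homogeneous (suc (suc j)) c χ (M ++ [ y ])
  homogeneous-∷ʳ Q {y} hom M⊆Q homM e e⊆M len with ⊆-∷ʳ-view e⊆M
  ... | inj₁ (e′ , refl , e′⊆M) = homM e′ e′⊆M (suc-injective (trans (sym (length-∷ʳ e′)) len))
  ... | inj₂ e⊆M′
    with S , x , v , refl , lenS ← lastTwo j e len
    with Q₁ , ℓ , Q₂ , refl , S⊆Q₁ , v⊆Q₂ ← decompose S {R = [ v ]} Q (⊆-trans e⊆M′ M⊆Q)
    = begin
      χ (S ++ x ∷ v ∷ [])      ≡⟨ colour-∷ʳ Q₁ (endHomogeneous-at [] Q₁ hom) S⊆Q₁ lenS (to∈ v⊆Q₂) ⟩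
      χ (S ++ x ∷ y ∷ [])       ≡⟨ cong χ (++-assoc S [ x ] [ y ]) ⟨
      χ ((S ++ [ x ]) ++ [ y ]) ≡⟨ homM (S ++ [ x ]) (⊆-trans (++⁺ ⊆-refl (refl ∷ v ∷ʳ [])) e⊆M′)
                                        (trans (length-∷ʳ S) (cong suc lenS)) ⟩
      _                         ∎
    where open ≡-Reasoning

  homogeneousSubset : ∀ A → Unique A → suc (treeSize (length (steppingLabels j L)) L) ≤ length A →
                      ∃[ M ] M ⊆ A × length M ≡ suc t × ∃[ c ] Homogeneous (suc (suc j)) c χ M
  homogeneousSubset A unique h
    with Q , y , lenQ , P⊆A , hom ← endHomogeneous L [] A refl h
    with M , M⊆Q , lenM , c , homM ← arrows (map proj₁ Q) (⊆-unique (⊆-trans (++⁺ʳ [ y ] ⊆-refl) P⊆A) unique)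
                                            (≤-reflexive (sym (trans (length-map proj₁ Q) lenQ))) (λ e → χ (e ++ [ y ]))
    = M ++ [ y ] , ⊆-trans (++⁺ M⊆Q ⊆-refl) P⊆A , trans (length-∷ʳ M) (cong suc lenM) , c ,
      homogeneous-∷ʳ Q hom M⊆Q homM

steppingUp : ∀ {V} j t L → ListArrows V (suc j) t L →
             ListArrows V (suc (suc j)) (suc t) (suc (treeSize (length (steppingLabels j L)) L))
steppingUp j t L arrows A unique h χ = SteppingUp.homogeneousSubset j t L arrows χ A unique h

-- Arithmetic of the bounds

suc-erdősSzekeres : ∀ a b → suc (erdősSzekeres a b) ≡ (a + b) C a
suc-erdősSzekeres zero b = refl
suc-erdősSzekeres (suc a) zero = trans (sym (nCn≡1 (suc a))) (cong (_C suc a) (sym (+-identityʳ (suc a))))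
suc-erdősSzekeres (suc a) (suc b) = begin
  suc (suc (erdősSzekeres a (suc b) + erdősSzekeres (suc a) b))
    ≡⟨ cong suc (+-suc (erdősSzekeres a (suc b)) (erdősSzekeres (suc a) b)) ⟨
  suc (erdősSzekeres a (suc b)) + suc (erdősSzekeres (suc a) b)
    ≡⟨ cong₂ _+_ (suc-erdősSzekeres a (suc b)) (suc-erdősSzekeres (suc a) b) ⟩
  (a + suc b) C a + (suc a + b) C suc a
    ≡⟨ cong (λ n → (a + suc b) C a + n C suc a) (+-suc a b) ⟨
  (a + suc b) C a + (a + suc b) C suc a
    ≡⟨ nCk+nC[k+1]≡[n+1]C[k+1] (a + suc b) a ⟩
  suc (a + suc b) C suc a ∎
  where open ≡-Reasoning

≤-erdősSzekeres : ∀ a b → a ≤ erdősSzekeres a (suc b)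
≤-erdősSzekeres zero b = z≤n
≤-erdősSzekeres (suc a) b = s≤s (≤-trans (≤-erdősSzekeres a b) (m≤m+n _ _))

centralBinomial : ℕ → ℕ
centralBinomial s = (2 * s) C s

branchLength≡centralBinomial : ∀ s → branchLength s ≡ centralBinomial s
branchLength≡centralBinomial s = trans (suc-erdősSzekeres s s) (cong (_C s) (cong (s +_) (sym (+-identityʳ s))))

suc≤branchLength : ∀ s → suc s ≤ branchLength s
suc≤branchLength zero = s≤s z≤n
suc≤branchLength (suc s) = s≤s (≤-erdősSzekeres (suc s) s)

n<2^n : ∀ n → n < 2 ^ n
n<2^n zero = s≤s z≤n
n<2^n (suc n) = begin-strict
  suc n            <⟨ s≤s (n<2^n n) ⟩
  suc (2 ^ n)      ≤⟨ +-monoˡ-≤ (2 ^ n) (m^n>0 2 n) ⟩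
  2 ^ n + 2 ^ n    ≡⟨ cong (2 ^ n +_) (+-identityʳ (2 ^ n)) ⟨
  2 ^ suc n        ∎
  where open ≤-Reasoning

1≤length-words : ∀ {A : Set} n (E : List A) → 1 ≤ length (words n E)
1≤length-words zero E = s≤s z≤n
1≤length-words (suc n) E = s≤s z≤n

suc-length-words-bits : ∀ n → suc (length (words n bits)) ≤ 2 ^ suc n
suc-length-words-bits n = subst (λ l → suc l ≤ 2 ^ suc n) (sym (length-words n bits)) (treeSize<^ (suc n) ≤-refl)

treeSize-bound : ∀ {M e} n → 1 ≤ M → suc M ≤ 2 ^ e → suc (treeSize M n) ≤ 2 ^ (e * n)
treeSize-bound {M} {e} n 1≤M M<2^e = begin
  suc (treeSize M n)  ≤⟨ treeSize<suc^ n 1≤M ⟩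
  suc M ^ n           ≤⟨ ^-monoˡ-≤ n M<2^e ⟩
  (2 ^ e) ^ n         ≡⟨ ^-*-assoc 2 e n ⟩
  2 ^ (e * n)         ∎
  where open ≤-Reasoning

wordsThreshold : ∀ m n → suc (treeSize (length (words m bits)) n) ≤ 2 ^ (suc m * n)
wordsThreshold m n = treeSize-bound {e = suc m} n (1≤length-words m bits) (suc-length-words-bits m)

T-mono : ∀ i {x y} → x ≤ y → T i x ≤ T i y
T-mono zero x≤y = x≤y
T-mono (suc i) x≤y = ^-monoʳ-≤ 2 (T-mono i x≤y)

T-inflationary : ∀ i x → x ≤ T i x
T-inflationary zero x = ≤-refl
T-inflationary (suc i) x = ≤-trans (T-inflationary i x) (<⇒≤ (n<2^n (T i x)))

suc-T≤T-suc : ∀ i x → suc (T i x) ≤ T i (suc x)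
suc-T≤T-suc zero x = ≤-refl
suc-T≤T-suc (suc i) x = begin
  suc (2 ^ T i x)          ≤⟨ +-monoˡ-≤ (2 ^ T i x) (m^n>0 2 (T i x)) ⟩
  2 ^ T i x + 2 ^ T i x    ≡⟨ cong (2 ^ T i x +_) (+-identityʳ (2 ^ T i x)) ⟨
  2 ^ suc (T i x)          ≤⟨ ^-monoʳ-≤ 2 (suc-T≤T-suc i x) ⟩
  2 ^ T i (suc x)          ∎
  where open ≤-Reasoning

T-absorbs : ∀ i {z d} → 5 + i ≤ z → 3 ≤ d → T (suc i) z * (5 + i) ≤ T (suc i) (z + d)
T-absorbs zero {z} {d} _ 3≤d = begin
  2 ^ z * 5        ≤⟨ *-monoʳ-≤ (2 ^ z) (≤-trans (m≤m+n 5 3) (^-monoʳ-≤ 2 3≤d)) ⟩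
  2 ^ z * 2 ^ d    ≡⟨ ^-distribˡ-+-* 2 z d ⟨
  2 ^ (z + d)      ∎
  where open ≤-Reasoning
T-absorbs (suc i) {z} {d} 6+i≤z 3≤d = begin
  T (2 + i) z * (6 + i)              ≤⟨ *-monoʳ-≤ (T (2 + i) z) (≤-trans 6+i≤z (T-inflationary (2 + i) z)) ⟩
  T (2 + i) z * T (2 + i) z          ≡⟨ ^-distribˡ-+-* 2 (T (suc i) z) (T (suc i) z) ⟨
  2 ^ (T (suc i) z + T (suc i) z)    ≡⟨ cong (λ n → 2 ^ (T (suc i) z + n)) (+-identityʳ (T (suc i) z)) ⟨
  2 ^ (2 ^ suc (T i z))              ≤⟨ ^-monoʳ-≤ 2 (^-monoʳ-≤ 2 (suc-T≤T-suc i z)) ⟩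
  2 ^ (2 ^ T i (suc z))              ≤⟨ ^-monoʳ-≤ 2 (^-monoʳ-≤ 2 (T-mono i suc-z≤z+d)) ⟩
  T (2 + i) (z + d)                  ∎
  where
  open ≤-Reasoning
  suc-z≤z+d : suc z ≤ z + d
  suc-z≤z+d = subst (_≤ z + d) (+-comm z 1) (+-monoʳ-≤ z (≤-trans (s≤s z≤n) 3≤d))

triplesBound : ∀ s → suc (treeSize (length (positionLabels s)) (branchLength s)) ≤
                     T 1 (2 * (2 + s) * centralBinomial s)
triplesBound s = begin
  suc (treeSize (length (positionLabels s)) (branchLength s))
    ≤⟨ wordsThreshold (s + s) (branchLength s) ⟩
  2 ^ (suc (s + s) * branchLength s)
    ≤⟨ ^-monoʳ-≤ 2 (*-mono-≤ (m≤n+m (suc (s + s)) 3) (≤-reflexive (branchLength≡centralBinomial s))) ⟩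
  2 ^ ((3 + suc (s + s)) * centralBinomial s)
    ≡⟨ cong (λ n → 2 ^ (n * centralBinomial s)) (exponent s) ⟩
  2 ^ (2 * (2 + s) * centralBinomial s) ∎
  where
  open ≤-Reasoning
  exponent : ∀ s → 3 + suc (s + s) ≡ 2 * (2 + s)
  exponent = solve-∀

quadruplesBound : ∀ s → suc (treeSize (length (addressLabels s)) (quadrupleDepth s)) ≤
                        T 2 (2 * (3 + s) * centralBinomial s)
quadruplesBound s = begin
  suc (treeSize (length (addressLabels s)) (quadrupleDepth s))
    ≤⟨ treeSize-bound {e = e * suc c} (quadrupleDepth s) (1≤length-words c (positionLabels s)) addressLabels-bound ⟩
  2 ^ (e * suc c * quadrupleDepth s)
    ≤⟨ ^-monoʳ-≤ 2 (*-mono-≤ factor≤ (wordsThreshold (s + s) c)) ⟩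
  2 ^ (2 ^ (e + suc c) * 2 ^ (e * c))
    ≡⟨ cong (2 ^_) (^-distribˡ-+-* 2 (e + suc c) (e * c)) ⟨
  2 ^ (2 ^ (e + suc c + e * c))
    ≤⟨ ^-monoʳ-≤ 2 (^-monoʳ-≤ 2 exponent≤) ⟩
  2 ^ (2 ^ (2 * (3 + s) * centralBinomial s)) ∎
  where
  open ≤-Reasoning
  c e : ℕ
  c = branchLength s
  e = suc (s + s)
  addressLabels-bound : suc (length (addressLabels s)) ≤ 2 ^ (e * suc c)
  addressLabels-bound =
    subst (λ l → suc l ≤ 2 ^ (e * suc c)) (sym (length-words c (positionLabels s)))
          (treeSize-bound {e = e} (suc c) (1≤length-words (s + s) bits) (suc-length-words-bits (s + s)))
  factor≤ : e * suc c ≤ 2 ^ (e + suc c)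
  factor≤ = ≤-trans (*-mono-≤ (<⇒≤ (n<2^n e)) (<⇒≤ (n<2^n (suc c))))
                    (≤-reflexive (sym (^-distribˡ-+-* 2 e (suc c))))
  regroup : ∀ s c → suc (s + s) + suc c + suc (s + s) * c ≡ (suc s + suc s) + c + suc (s + s) * c
  regroup = solve-∀
  collect : ∀ s c → (c + c) + c + suc (s + s) * c + (c + c) ≡ 2 * (3 + s) * c
  collect = solve-∀
  s<c : suc s ≤ c
  s<c = suc≤branchLength s
  exponent≤ : e + suc c + e * c ≤ 2 * (3 + s) * centralBinomial s
  exponent≤ = begin
    e + suc c + e * c                  ≡⟨ regroup s c ⟩
    (suc s + suc s) + c + e * c        ≤⟨ +-monoˡ-≤ (e * c) (+-monoˡ-≤ c (+-mono-≤ s<c s<c)) ⟩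
    (c + c) + c + e * c                ≤⟨ m≤m+n _ (c + c) ⟩
    (c + c) + c + e * c + (c + c)      ≡⟨ collect s c ⟩
    2 * (3 + s) * c                    ≡⟨ cong (2 * (3 + s) *_) (branchLength≡centralBinomial s) ⟩
    2 * (3 + s) * centralBinomial s    ∎

steppingBound : ∀ i z d → 5 + i ≤ z → 3 ≤ d →
                suc (treeSize (length (steppingLabels (3 + i) (T (2 + i) z))) (T (2 + i) z)) ≤ T (3 + i) (z + d)
steppingBound i z d 5+i≤z 3≤d = begin
  suc (treeSize (length (steppingLabels j L)) L)   ≤⟨ wordsThreshold (L ^ j) L ⟩
  2 ^ (suc (L ^ j) * L)                            ≤⟨ ^-monoʳ-≤ 2 exponent≤ ⟩
  2 ^ (2 ^ (u * (5 + i)))                          ≤⟨ ^-monoʳ-≤ 2 (^-monoʳ-≤ 2 (T-absorbs i 5+i≤z 3≤d)) ⟩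
  T (3 + i) (z + d)                                ∎
  where
  open ≤-Reasoning
  u j L : ℕ
  u = T (suc i) z
  j = 3 + i
  L = T (2 + i) z
  regroup : ∀ u i → u * (3 + i) + u + u ≡ u * (5 + i)
  regroup = solve-∀
  exponent≤ : suc (L ^ j) * L ≤ 2 ^ (u * (5 + i))
  exponent≤ = begin
    suc (L ^ j) * L                        ≡⟨ cong (λ n → suc n * L) (^-*-assoc 2 u j) ⟩
    suc (2 ^ (u * j)) * 2 ^ u              ≤⟨ *-monoˡ-≤ (2 ^ u) (+-monoˡ-≤ (2 ^ (u * j)) (m^n>0 2 (u * j))) ⟩
    (2 ^ (u * j) + 2 ^ (u * j)) * 2 ^ u    ≡⟨ cong (λ n → (2 ^ (u * j) + n) * 2 ^ u) (+-identityʳ (2 ^ (u * j))) ⟨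
    2 ^ suc (u * j) * 2 ^ u                ≡⟨ ^-distribˡ-+-* 2 (suc (u * j)) u ⟨
    2 ^ (suc (u * j) + u)                  ≡⟨ cong (2 ^_) (+-comm 1 (u * j + u)) ⟩
    2 ^ (u * j + u + 1)                    ≤⟨ ^-monoʳ-≤ 2 (+-monoʳ-≤ (u * j + u) (m^n>0 2 (T i z))) ⟩
    2 ^ (u * j + u + u)                    ≡⟨ cong (2 ^_) (regroup u i) ⟩
    2 ^ (u * (5 + i))                      ∎

2≤centralBinomial : ∀ s → 1 ≤ s → 2 ≤ centralBinomial s
2≤centralBinomial s 1≤s = subst (2 ≤_) (branchLength≡centralBinomial s) (≤-trans (s≤s 1≤s) (suc≤branchLength s))

listArrows-tower : ∀ {V} m s → 1 ≤ s →
                   ListArrows V (3 + m) (m + suc (suc s)) (T (suc m) (2 * (m + suc (suc s)) * centralBinomial s))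
listArrows-tower zero s _ = ListArrows-mono (triplesBound s) (triples s)
listArrows-tower (suc zero) s _ = ListArrows-mono (quadruplesBound s) (quadruples s)
listArrows-tower (suc (suc i)) s 1≤s =
  ListArrows-mono bound (steppingUp (3 + i) t (T (2 + i) z) (listArrows-tower (suc i) s 1≤s))
  where
  t z : ℕ
  t = suc i + suc (suc s)
  z = 2 * t * centralBinomial s
  split-t : ∀ i s → 2 * (suc i + suc (suc s)) ≡ (5 + i) + (i + 2 * s + 1)
  split-t = solve-∀
  shift : ∀ t c → 2 * suc t * c ≡ 2 * t * c + 2 * c
  shift = solve-∀
  5+i≤z : 5 + i ≤ z
  5+i≤z = begin
    5 + i                       ≤⟨ m≤m+n (5 + i) _ ⟩
    (5 + i) + (i + 2 * s + 1)   ≡⟨ split-t i s ⟨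
    2 * t                       ≡⟨ *-identityʳ (2 * t) ⟨
    2 * t * 1                   ≤⟨ *-monoʳ-≤ (2 * t) (≤-trans (s≤s z≤n) (2≤centralBinomial s 1≤s)) ⟩
    z                           ∎
    where open ≤-Reasoning
  bound : suc (treeSize (length (steppingLabels (3 + i) (T (2 + i) z))) (T (2 + i) z)) ≤
          T (3 + i) (2 * suc t * centralBinomial s)
  bound = ≤-trans (steppingBound i z (2 * centralBinomial s) 5+i≤z 3≤2c)
                  (≤-reflexive (cong (T (3 + i)) (sym (shift t (centralBinomial s)))))
    where
    3≤2c : 3 ≤ 2 * centralBinomial s
    3≤2c = ≤-trans (s≤s (s≤s (s≤s z≤n))) (*-monoʳ-≤ 2 (2≤centralBinomial s 1≤s))

listArrows : ∀ {V} k t → 3 ≤ k → k < t → ListArrows V k t (T (k ∸ 2) (baseQuantity k t))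
listArrows {V} (suc (suc (suc m))) t (s≤s (s≤s (s≤s _))) k<t with w , refl ← m≤n⇒∃[o]m+o≡n k<t =
  subst₂ (ListArrows V (3 + m)) t≡ (cong (T (suc m)) (cong₂ (λ t s → 2 * t * centralBinomial s) t≡ (sym s≡)))
         (listArrows-tower m (suc (suc w)) (s≤s z≤n))
  where
  k : ℕ
  k = 3 + m
  reassoc : ∀ m w → m + suc (suc (suc (suc w))) ≡ suc (3 + m) + w
  reassoc = solve-∀
  t≡ : m + suc (suc (suc (suc w))) ≡ suc k + w
  t≡ = reassoc m w
  s≡ : suc k + w + 1 ∸ k ≡ suc (suc w)
  s≡ = trans (cong (_∸ k) (solve₂ m w)) (m+n∸m≡n k (suc (suc w)))
    where
    solve₂ : ∀ m w → suc (3 + m) + w + 1 ≡ (3 + m) + suc (suc w)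
    solve₂ = solve-∀

-- From lists of distinct vertices to subsets

module _ {n : ℕ} where

  fromList : List (Fin n) → Subset n
  fromList [] = ∅
  fromList (x ∷ xs) = ⁅ x ⁆ ∪ fromList xs

  ∈-fromList⁻ : ∀ {x} xs → x ∈ₛ fromList xs → x ∈ xs
  ∈-fromList⁻ [] x∈ = ⊥-elim (∉⊥ x∈)
  ∈-fromList⁻ (y ∷ xs) x∈ with x∈p∪q⁻ ⁅ y ⁆ (fromList xs) x∈
  ... | inj₁ x∈⁅y⁆ = here (x∈⁅y⁆⇒x≡y y x∈⁅y⁆)
  ... | inj₂ x∈xs = there (∈-fromList⁻ xs x∈xs)

  ∈-fromList⁺ : ∀ {x} xs → x ∈ xs → x ∈ₛ fromList xs
  ∈-fromList⁺ (y ∷ xs) (here refl) = x∈p∪q⁺ (inj₁ (x∈⁅x⁆ y))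
  ∈-fromList⁺ (y ∷ xs) (there x∈xs) = x∈p∪q⁺ (inj₂ (∈-fromList⁺ xs x∈xs))

  ∣fromList∣ : ∀ xs → Unique xs → ∣ fromList xs ∣ ≡ length xs
  ∣fromList∣ [] _ = ∣⊥∣≡0 n
  ∣fromList∣ (x ∷ xs) (x∉xs ∷ unique) =
    trans (∣⁅x⁆∪p∣ x (fromList xs) (λ x∈ → All.lookup x∉xs (∈-fromList⁻ xs x∈) refl))
          (cong suc (∣fromList∣ xs unique))
    where
    ∣⁅x⁆∪p∣ : ∀ {m} (x : Fin m) p → x ∉ₛ p → ∣ ⁅ x ⁆ ∪ p ∣ ≡ suc ∣ p ∣
    ∣⁅x⁆∪p∣ zero (true ∷ p) x∉p = ⊥-elim (x∉p here)
    ∣⁅x⁆∪p∣ zero (false ∷ p) _ = cong (suc ∘ ∣_∣) (∪-identityˡ p)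
    ∣⁅x⁆∪p∣ (suc x) (true ∷ p) x∉p = cong suc (∣⁅x⁆∪p∣ x p (x∉p ∘ there))
    ∣⁅x⁆∪p∣ (suc x) (false ∷ p) x∉p = ∣⁅x⁆∪p∣ x p (x∉p ∘ there)

listArrows⇒Arrows : ∀ {k t N} → ListArrows (Fin N) k t N → Arrows k t N
listArrows⇒Arrows {k} {t} {N} arrows c
  with M , M⊆ , lenM , b , hom ← arrows (allFin N) (allFin⁺ N) (≤-reflexive (sym (length-tabulate {n = N} (λ i → i))))
                                        (c ∘ fromList)
  = fromList M , trans (∣fromList∣ M uniqueM) lenM , b , homogeneous
  where
  uniqueM : Unique M
  uniqueM = ⊆-unique M⊆ (allFin⁺ N)
  homogeneous : (e : Subset N) → e ⊆ₛ fromList M → ∣ e ∣ ≡ k → c e ≡ b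
  homogeneous e e⊆M ∣e∣≡k = subst (λ e′ → c e′ ≡ b) (sym e≡) (hom elements (filter-⊆ (_∈? e) M) length≡)
    where
    elements : List (Fin N)
    elements = filter (_∈? e) M
    e≡ : e ≡ fromList elements
    e≡ = ⊆ₛ-antisym (λ x∈e → ∈-fromList⁺ elements (∈-filter⁺ (_∈? e) (∈-fromList⁻ M (e⊆M x∈e)) x∈e))
                    (λ x∈ → proj₂ (∈-filter⁻ (_∈? e) {xs = M} (∈-fromList⁻ elements x∈)))
    length≡ : length elements ≡ k
    length≡ = trans (sym (∣fromList∣ elements (⊆-unique (filter-⊆ (_∈? e) M) uniqueM)))
                    (trans (cong ∣_∣ (sym e≡)) ∣e∣≡k)

∀-boolFunction? : ∀ n {P : (Vec Bool n → Bool) → Set} → (∀ {f g} → (∀ v → f v ≡ g v) → P f → P g) →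
                  (∀ f → Dec (P f)) → Dec (∀ f → P f)
∀-boolFunction? zero {P} resp P? =
  map′ fromConstants (λ all → all _ , all _) (P? (λ _ → true) ×-dec P? (λ _ → false))
  where
  fromConstants : P (λ _ → true) × P (λ _ → false) → ∀ f → P f
  fromConstants (Ptrue , Pfalse) f with f [] in eq
  ... | true = resp (λ { [] → sym eq }) Ptrue
  ... | false = resp (λ { [] → sym eq }) Pfalse
∀-boolFunction? (suc n) {P} resp P? =
  map′ (λ all f → resp (λ { (false ∷ v) → refl ; (true ∷ v) → refl }) (all (f ∘ (false ∷_)) (f ∘ (true ∷_))))
       (λ all g h → all (cases g h))
       (∀-boolFunction? n (λ g≗g′ all h → resp (λ { (false ∷ v) → g≗g′ v ; (true ∷ v) → refl }) (all h))
         (λ g → ∀-boolFunction? n (λ h≗h′ → resp (λ { (false ∷ v) → refl ; (true ∷ v) → h≗h′ v }))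
                                  (λ h → P? (cases g h))))
  where
  cases : (Vec Bool n → Bool) → (Vec Bool n → Bool) → Vec Bool (suc n) → Bool
  cases g h (false ∷ v) = g v
  cases g h (true ∷ v) = h v

∀-subset? : ∀ {n} {P : Subset n → Set} → (∀ e → Dec (P e)) → Dec (∀ e → P e)
∀-subset? P? with anySubset? (λ e → ¬? (P? e))
... | yes (e , ¬Pe) = no (λ all → ¬Pe (all e))
... | no ∄¬P = yes (λ e → decidable-stable (P? e) (λ ¬Pe → ∄¬P (e , ¬Pe)))

hasMonoClique? : ∀ k t n c → Dec (HasMonoClique k t n c)
hasMonoClique? k t n c = anySubset? (λ S → (∣ S ∣ ≟ t) ×-dec monochromatic? S)
  where
  colouredBy? : ∀ S b → Dec ((e : Subset n) → e ⊆ₛ S → ∣ e ∣ ≡ k → c e ≡ b)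
  colouredBy? S b = ∀-subset? (λ e → (e ⊆? S) →-dec ((∣ e ∣ ≟ k) →-dec (c e Bool.≟ b)))
  monochromatic? : ∀ S → Dec (∃[ b ] ((e : Subset n) → e ⊆ₛ S → ∣ e ∣ ≡ k → c e ≡ b))
  monochromatic? S = map′ (λ { (inj₁ p) → true , p ; (inj₂ p) → false , p })
                          (λ { (true , p) → inj₁ p ; (false , p) → inj₂ p })
                          (colouredBy? S true ⊎-dec colouredBy? S false)

arrows? : ∀ k t n → Dec (Arrows k t n)
arrows? k t n = ∀-boolFunction? n recolour (hasMonoClique? k t n)
  where
  recolour : ∀ {c c′} → (∀ e → c e ≡ c′ e) → HasMonoClique k t n c → HasMonoClique k t n c′
  recolour c≗c′ (S , ∣S∣ , b , mono) = S , ∣S∣ , b , λ e e⊆S ∣e∣ → trans (sym (c≗c′ e)) (mono e e⊆S ∣e∣)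

least : ∀ {P : ℕ → Set} → (∀ n → Dec (P n)) → ∀ N → P N → ∃[ r ] r ≤ N × P r × ∀ n → P n → r ≤ n
least {P} P? N PN = leastUpTo N (N , ≤-refl , PN)
  where
  leastUpTo : ∀ N → ∃[ n ] n ≤ N × P n → ∃[ r ] r ≤ N × P r × ∀ n → P n → r ≤ n
  leastUpTo zero (zero , z≤n , P0) = zero , z≤n , P0 , λ _ _ → z≤n
  leastUpTo (suc N) (n , n≤N , Pn) with anyUpTo? P? (suc N)
  ... | yes (m , s≤s m≤N , Pm) with r , r≤N , Pr , minimal ← leastUpTo N (m , m≤N , Pm) =
    r , m≤n⇒m≤1+n r≤N , Pr , minimal
  ... | no ∄ = n , n≤N , Pn , λ m Pm → ≮⇒≥ (λ m<n → ∄ (m , <-≤-trans m<n n≤N , Pm))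

corollary1p2 : (m : ℕ) → Σ ℕ λ t₀ → (t k : ℕ) → t₀ ≤ t → 3 ≤ k → k < t →
    Σ ℕ λ r → IsRamseyNumber k t r × r ≤ T (k ∸ 2) (boosted m (baseQuantity k t))
corollary1p2 m = 0 , λ t k _ 3≤k k<t →
  let r , r≤bound , arrows , minimal = least (arrows? k t) _ (listArrows⇒Arrows (listArrows k t 3≤k k<t))
  in r , (arrows , minimal) , ≤-trans r≤bound (T-mono (k ∸ 2) (m≤m+n _ _))
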